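{- Let $G$ be a finite graph on $n$ vertices and $k$ a natural number, and let $\mathcal{B}$ be either $\mathcal{B}(G)$, or $\mathcal{B}_{\geq k}(G)$ with $k\le n-1$. Let $P\in V(\mathcal{B})$. If $P$ has a part of size $2$ and a part of size $1$ with no edges of $G$ between them, then either $P$ does not satisfy Property 1, or $\mathcal{B}=\mathcal{B}_{\geq k}(G)$ and $P$ has exactly $k$ parts.
   Context: An independent set partition of $G$ is a partition of $V(G)$ into nonempty independent sets (parts). For such a partition $P$ and $v\in V(G)$, let $P-v$ be the partition of $V(G)\setminus\{v\}$ obtained by deleting $v$ from its part (discarding that part if empty). The Bell colouring graph $\mathcal{B}(G)$ has as vertices the independent set partitions of $G$, with $P\neq Q$ adjacent iff $P-v=Q-v$ for some $v\in V(G)$; $\mathcal{B}_{\geq k}(G)$ is its induced subgraph on partitions with at least $k$ parts. For $P\in V(\mathcal{B})$, $N(P)$ is its set of neighbours in $\mathcal{B}$ and $N[P]=N(P)\cup\{P\}$. Property 1 (of $P$ in $\mathcal{B}$): any two neighbours of $P$ which are not adjacent to each other have exactly one common neighbour $R$ in $\mathcal{B}$ outside $N[P]$, and no other neighbour of $P$ is adjacent to $R$. -}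

module Defs where

open import Data.Nat using (ℕ; _≤_; _<ᵇ_)
open import Data.Fin using (Fin; toℕ)
open import Data.Bool using (Bool; true; false; not; _∧_)
open import Data.List using (List; length; filterᵇ; allFin)
open import Data.Bool.ListAction using (any)
open import Data.Maybe using (Maybe; just; nothing)
open import Data.Unit using (⊤)
open import Data.Product using (Σ; ∃; _×_)
open import Relation.Nullary using (¬_)
open import Relation.Binary.PropositionalEquality using (_≡_; _≢_)

record Graph (n : ℕ) : Set₁ where
  field
    Adj     : Fin n → Fin n → Set
    sym     : ∀ {u v} → Adj u v → Adj v u
    irrefl  : ∀ {u} → ¬ Adj u u
open Graph public

-- An independent set partition of G, represented by its (decidable)
-- "same part" equivalence relation on V(G); parts are the equivalence
-- classes, which are nonempty by construction, and must be independent.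
record ISPartition {n : ℕ} (G : Graph n) : Set where
  field
    same      : Fin n → Fin n → Bool
    same-refl : ∀ u → same u u ≡ true
    same-sym  : ∀ u v → same u v ≡ true → same v u ≡ true
    same-trans : ∀ u v w → same u v ≡ true → same v w ≡ true → same u w ≡ true
    indep     : ∀ u v → same u v ≡ true → ¬ Adj G u v
open ISPartition public

module _ {n : ℕ} {G : Graph n} where

  _≈P_ : ISPartition G → ISPartition G → Set
  P ≈P Q = ∀ u v → same P u v ≡ same Q u v

  AgreeOff : Fin n → ISPartition G → ISPartition G → Set
  AgreeOff v P Q = ∀ a b → a ≢ v → b ≢ v → same P a b ≡ same Q a b

  BAdj : ISPartition G → ISPartition G → Set
  BAdj P Q = ¬ (P ≈P Q) × ∃ λ v → AgreeOff v P Q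

  partSize : ISPartition G → Fin n → ℕ
  partSize P v = length (filterᵇ (same P v) (allFin n))

  isLeader : ISPartition G → Fin n → Bool
  isLeader P v = not (any (λ u → (toℕ u <ᵇ toℕ v) ∧ same P u v) (allFin n))

  numParts : ISPartition G → ℕ
  numParts P = length (filterᵇ (isLeader P) (allFin n))

  -- Which Bell colouring graph: nothing = B(G), just k = B_{≥k}(G).
  InB : Maybe ℕ → ISPartition G → Set
  InB nothing  P = ⊤
  InB (just k) P = k ≤ numParts P

  Property1 : Maybe ℕ → ISPartition G → Set
  Property1 mb P =
    ∀ Q₁ Q₂ → InB mb Q₁ → InB mb Q₂ → BAdj P Q₁ → BAdj P Q₂ →
    ¬ (Q₁ ≈P Q₂) → ¬ BAdj Q₁ Q₂ →
    Σ (ISPartition G) λ R →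
      InB mb R × BAdj Q₁ R × BAdj Q₂ R × ¬ (R ≈P P) × ¬ BAdj P R
      × (∀ R' → InB mb R' → BAdj Q₁ R' → BAdj Q₂ R' →
           ¬ (R' ≈P P) → ¬ BAdj P R' → R' ≈P R)
      × (∀ Q → InB mb Q → BAdj P Q → ¬ (Q ≈P Q₁) → ¬ (Q ≈P Q₂) → ¬ BAdj Q R)

{-# OPTIONS --safe #-}
module Submission where

open import Defs renaming (sym to Adj-sym)
open import Data.Nat using (ℕ; _≤_; _<_; _∸_; suc; z≤n; s≤s; s≤s⁻¹)
open import Data.Nat.Properties
  using (m≤n⇒m≤1+n; ≤-trans; ≤-antisym; ≮⇒≥; ≤∧≢⇒<; <-asym; ≤-<-trans; <ᵇ⇒<; <⇒<ᵇ)
  renaming (_≟_ to _≟ℕ_)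
open import Data.Fin using (Fin; toℕ; _≟_)
open import Data.Fin.Properties using (toℕ-injective)
open import Data.Bool using (Bool; true; false; _∧_; _∨_; not)
import Data.Bool as Bool
open import Data.Bool.Properties using (T-≡; T-∧; not-injective)
open import Data.List using (List; []; _∷_; length; filterᵇ; allFin)
open import Data.List.Membership.Propositional using (_∈_; lose)
open import Data.List.Membership.Propositional.Properties using (∈-allFin; ∈-filter⁺; ∈-filter⁻)
open import Data.List.Relation.Unary.Any using (here; there; satisfied)
open import Data.List.Relation.Unary.Any.Properties using (any⁺; any⁻)
open import Data.List.Relation.Unary.All using ([]; _∷_; lookup)
open import Data.List.Relation.Unary.AllPairs using ([]; _∷_)
open import Data.List.Relation.Unary.Unique.Propositional using (Unique)
open import Data.List.Relation.Unary.Unique.Propositional.Properties using (allFin⁺; filter⁺)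
open import Data.Maybe using (Maybe; just; nothing)
open import Data.Product using (∃; _×_; _,_; proj₁; proj₂)
open import Data.Sum using (_⊎_; inj₁; inj₂; [_,_])
open import Data.Empty using (⊥; ⊥-elim)
open import Data.Unit using (tt)
open import Function using (_∘_; id)
open import Function.Bundles using (Equivalence; _⇔_; mk⇔)
open import Relation.Nullary using (¬_; Dec; yes; no; does; contradiction)
open import Relation.Nullary.Decidable using (T?; dec-true; does-⇔)
open import Relation.Binary.PropositionalEquality
  using (_≡_; _≢_; refl; sym; trans; cong; ≢-sym)

-- Let {a, b} and {c} be the two parts.  P is adjacent to Q₁ (move c into
-- {a, b}) and to Q₂ (move a out into a new part).  These neighbours are
-- distinct and non-adjacent, since Q₁ joins and Q₂ separates each pair of
-- a, b, c.  A common neighbour R of Q₁ and Q₂ is one move away from each, so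
-- those two moves must touch all three pairs; checking the few ways to do so
-- shows that R is one move away from P, i.e. R lies in N[P], so Property 1
-- fails.  This needs Q₁ and Q₂ in the Bell colouring graph at hand: Q₂ has one
-- part more than P and Q₁ one fewer, so in B≥k only |P| = k is exempt.

true⇔true⇒≡ : ∀ {x y} → (x ≡ true → y ≡ true) → (y ≡ true → x ≡ true) → x ≡ y
true⇔true⇒≡ {false} {false} _ _ = refl
true⇔true⇒≡ {false} {true}  _ g = g refl
true⇔true⇒≡ {true}  {_}     f _ = sym (f refl)

∧-true⁻ : ∀ {x y} → x ∧ y ≡ true → x ≡ true × y ≡ true
∧-true⁻ {true} {true} _ = refl , refl

∧-true⁺ : ∀ {x y} → x ≡ true → y ≡ true → x ∧ y ≡ true
∧-true⁺ refl refl = refl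

∨-true⁻ : ∀ {x y} → x ∨ y ≡ true → x ≡ true ⊎ y ≡ true
∨-true⁻ {true}  _ = inj₁ refl
∨-true⁻ {false} p = inj₂ p

∨-true⁺ : ∀ {x y} → x ≡ true ⊎ y ≡ true → x ∨ y ≡ true
∨-true⁺ {true}  _          = refl
∨-true⁺ {false} (inj₂ p)   = p

from-does : ∀ {A : Set} (d : Dec A) → does d ≡ true → A
from-does (yes a) _ = a

module _ {A : Set} where

  length-filterᵇ-mono : ∀ {f g : A → Bool} xs → (∀ {y} → y ∈ xs → f y ≡ true → g y ≡ true) →
    length (filterᵇ f xs) ≤ length (filterᵇ g xs)
  length-filterᵇ-mono [] _ = z≤n
  length-filterᵇ-mono {f} {g} (x ∷ xs) f⇒g with f x in fx | g x in gx
  ... | true  | true  = s≤s (length-filterᵇ-mono xs (f⇒g ∘ there))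
  ... | true  | false = contradiction (trans (sym (f⇒g (here refl) fx)) gx) λ ()
  ... | false | true  = m≤n⇒m≤1+n (length-filterᵇ-mono xs (f⇒g ∘ there))
  ... | false | false = length-filterᵇ-mono xs (f⇒g ∘ there)

  length-filterᵇ-≤-suc : ∀ (f g : A → Bool) {xs} → Unique xs →
    (∀ {x y} → f x ≡ true → g x ≡ false → f y ≡ true → g y ≡ false → x ≡ y) →
    length (filterᵇ f xs) ≤ suc (length (filterᵇ g xs))
  length-filterᵇ-≤-suc f g {[]} _ _ = z≤n
  length-filterᵇ-≤-suc f g {x ∷ xs} (x∉xs ∷ xs!) once with f x in fx | g x in gx
  ... | true  | true  = s≤s (length-filterᵇ-≤-suc f g xs! once)
  ... | false | true  = m≤n⇒m≤1+n (length-filterᵇ-≤-suc f g xs! once)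
  ... | false | false = length-filterᵇ-≤-suc f g xs! once
  ... | true  | false = s≤s (length-filterᵇ-mono xs f⇒g)
    where
    f⇒g : ∀ {y} → y ∈ xs → f y ≡ true → g y ≡ true
    f⇒g {y} y∈xs fy with g y in gy
    ... | true  = refl
    ... | false = contradiction (once fx gx fy gy) (lookup x∉xs y∈xs)

  length≡1⇒≡ : ∀ (xs : List A) {x y} → length xs ≡ 1 → x ∈ xs → y ∈ xs → x ≡ y
  length≡1⇒≡ (_ ∷ []) refl (here refl) (here refl) = refl

  length≡2⇒other : ∀ (xs : List A) {x} → Unique xs → length xs ≡ 2 → x ∈ xs →
    ∃ λ y → y ≢ x × y ∈ xs × (∀ {z} → z ∈ xs → z ≡ x ⊎ z ≡ y)
  length≡2⇒other (_ ∷ _ ∷ []) ((x≢y ∷ []) ∷ _) refl (here refl) =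
    _ , ≢-sym x≢y , there (here refl) ,
    λ { (here refl) → inj₁ refl ; (there (here refl)) → inj₂ refl }
  length≡2⇒other (_ ∷ _ ∷ []) ((x≢y ∷ []) ∷ _) refl (there (here refl)) =
    _ , x≢y , here refl ,
    λ { (here refl) → inj₂ refl ; (there (here refl)) → inj₁ refl }

module _ {n : ℕ} {G : Graph n} where

  infix 4 _∼[_]_ _⊑_

  _∼[_]_ : Fin n → ISPartition G → Fin n → Set
  u ∼[ P ] v = same P u v ≡ true

  _⊑_ : ISPartition G → ISPartition G → Set
  Q ⊑ P = ∀ {u v} → u ∼[ Q ] v → u ∼[ P ] v

  ∼-sym : ∀ P {u v} → u ∼[ P ] v → v ∼[ P ] u
  ∼-sym P = same-sym P _ _

  ∼-trans : ∀ P {u v w} → u ∼[ P ] v → v ∼[ P ] w → u ∼[ P ] w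
  ∼-trans P = same-trans P _ _ _

  ∼-mates : ∀ P {p u v} → p ∼[ P ] u → p ∼[ P ] v → u ∼[ P ] v
  ∼-mates P pu pv = ∼-trans P (∼-sym P pu) pv

  ≈P-sym : ∀ {P Q : ISPartition G} → P ≈P Q → Q ≈P P
  ≈P-sym P≈Q u v = sym (P≈Q u v)

  ≉-witness : ∀ (P Q : ISPartition G) {u v} → u ∼[ P ] v → ¬ u ∼[ Q ] v → ¬ P ≈P Q
  ≉-witness _ _ uv ¬uv P≈Q = ¬uv (trans (sym (P≈Q _ _)) uv)

  part : ISPartition G → Fin n → List (Fin n)
  part P v = filterᵇ (same P v) (allFin n)

  ∈-part : ∀ P {v u} → v ∼[ P ] u → u ∈ part P v
  ∈-part P {v} {u} vu = ∈-filter⁺ (T? ∘ same P v) (∈-allFin u) (Equivalence.from T-≡ vu)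

  partSize≡1⇒singleton : ∀ P {c} → partSize P c ≡ 1 → ∀ {u} → c ∼[ P ] u → u ≡ c
  partSize≡1⇒singleton P {c} size cu =
    length≡1⇒≡ (part P c) size (∈-part P cu) (∈-part P (same-refl P c))

  partSize≡2⇒doubleton : ∀ P {a} → partSize P a ≡ 2 →
    ∃ λ b → b ≢ a × a ∼[ P ] b × (∀ {u} → a ∼[ P ] u → u ≡ a ⊎ u ≡ b)
  partSize≡2⇒doubleton P {a} size
    with length≡2⇒other (part P a) (filter⁺ (T? ∘ same P a) (allFin⁺ n)) size
           (∈-part P (same-refl P a))
  ... | b , b≢a , b∈ , a-part = b , b≢a , member b∈ , a-part ∘ ∈-part P
    where
    member : ∀ {u} → u ∈ part P a → a ∼[ P ] u
    member = Equivalence.to T-≡ ∘ proj₂ ∘ ∈-filter⁻ (T? ∘ same P a) {xs = allFin n}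

  smaller-mate⇒nonleader : ∀ P {u v} → toℕ u < toℕ v → u ∼[ P ] v → isLeader P v ≡ false
  smaller-mate⇒nonleader P {u} u<v uv =
    cong not (Equivalence.to T-≡ (any⁺ _ (lose (∈-allFin u)
      (Equivalence.from T-∧ (<⇒<ᵇ u<v , Equivalence.from T-≡ uv)))))

  nonleader⇒smaller-mate : ∀ P {v} → isLeader P v ≡ false → ∃ λ u → toℕ u < toℕ v × u ∼[ P ] v
  nonleader⇒smaller-mate P nl
    with satisfied (any⁻ _ (allFin n) (Equivalence.from T-≡ (not-injective {y = true} nl)))
  ... | u , p with Equivalence.to T-∧ p
  ...   | u<v , uv = u , <ᵇ⇒< _ _ u<v , Equivalence.to T-≡ uv

  leader-minimal : ∀ P {u v} → isLeader P v ≡ true → u ∼[ P ] v → ¬ toℕ u < toℕ v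
  leader-minimal P lv uv u<v with () ← trans (sym lv) (smaller-mate⇒nonleader P u<v uv)

  leader-≤ : ∀ P {u v} → isLeader P v ≡ true → u ∼[ P ] v → toℕ v ≤ toℕ u
  leader-≤ P lv uv = ≮⇒≥ (leader-minimal P lv uv)

  leaders-unique : ∀ P {v w} → isLeader P v ≡ true → isLeader P w ≡ true → v ∼[ P ] w → v ≡ w
  leaders-unique P lv lw vw = toℕ-injective (≤-antisym (leader-≤ P lv (∼-sym P vw)) (leader-≤ P lw vw))

  leader-⊑ : ∀ {P Q : ISPartition G} → Q ⊑ P → ∀ {v} → isLeader P v ≡ true → isLeader Q v ≡ true
  leader-⊑ {P} {Q} Q⊑P {v} lv with isLeader Q v in lQv
  ... | true  = refl
  ... | false with nonleader⇒smaller-mate Q lQv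
  ...   | u , u<v , uv = contradiction u<v (leader-minimal P lv (Q⊑P uv))

  numParts-mono : ∀ {P Q : ISPartition G} → Q ⊑ P → numParts P ≤ numParts Q
  numParts-mono {P} {Q} Q⊑P = length-filterᵇ-mono (allFin n) (λ _ → leader-⊑ {P} {Q} Q⊑P)

  agreeOff-refl : ∀ {v} (P : ISPartition G) → AgreeOff v P P
  agreeOff-refl _ _ _ _ _ = refl

  agreeOff-trans : ∀ {v} (P Q R : ISPartition G) → AgreeOff v P Q → AgreeOff v Q R → AgreeOff v P R
  agreeOff-trans _ _ _ P≃Q Q≃R u w u≢v w≢v = trans (P≃Q u w u≢v w≢v) (Q≃R u w u≢v w≢v)

  agreeOff-separates : ∀ (Q Q' R : ISPartition G) {x y p q} → AgreeOff x Q R → AgreeOff y Q' R →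
    p ∼[ Q ] q → ¬ p ∼[ Q' ] q → p ≢ x → q ≢ x → p ≢ y → q ≢ y → ⊥
  agreeOff-separates _ _ _ Q≃R Q'≃R pq ¬pq p≢x q≢x p≢y q≢y =
    ¬pq (trans (Q'≃R _ _ p≢y q≢y) (trans (sym (Q≃R _ _ p≢x q≢x)) pq))

  -- R is Q with c moved next to the singleton q, while c is alone in P: off q, both
  -- P and R keep c alone and otherwise agree with Q.
  agreeOff-transfer : ∀ (P Q R : ISPartition G) {q c} → q ≢ c →
    (∀ {u} → c ∼[ P ] u → u ≡ c) → (∀ {u} → q ∼[ Q ] u → u ≡ q) →
    AgreeOff q P Q → AgreeOff c Q R → q ∼[ R ] c → AgreeOff q P R
  agreeOff-transfer P Q R {q} {c} q≢c c-single q-single P≃Q Q≃R q∼c = agree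
    where
    R-mate : ∀ {w} → w ≢ c → w ∼[ R ] c → w ≡ q
    R-mate {w} w≢c wc = q-single (∼-sym Q (trans (Q≃R w q w≢c q≢c) (∼-trans R wc (∼-sym R q∼c))))

    agree : AgreeOff q P R
    agree u v u≢q v≢q with u ≟ c | v ≟ c
    ... | no u≢c   | no v≢c   = trans (P≃Q u v u≢q v≢q) (Q≃R u v u≢c v≢c)
    ... | yes refl | yes refl = trans (same-refl P c) (sym (same-refl R c))
    ... | no u≢c   | yes refl =
      true⇔true⇒≡ (⊥-elim ∘ u≢c ∘ c-single ∘ ∼-sym P) (⊥-elim ∘ u≢q ∘ R-mate u≢c)
    ... | yes refl | no v≢c   =
      true⇔true⇒≡ (⊥-elim ∘ v≢c ∘ c-single) (⊥-elim ∘ v≢q ∘ R-mate v≢c ∘ ∼-sym R)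

  common-neighbours-near⇒¬Property1 : ∀ {mb} (P Q₁ Q₂ : ISPartition G) →
    InB mb Q₁ → InB mb Q₂ → BAdj P Q₁ → BAdj P Q₂ → ¬ Q₁ ≈P Q₂ → ¬ BAdj Q₁ Q₂ →
    (∀ {R} → BAdj Q₁ R → BAdj Q₂ R → ∃ λ v → AgreeOff v P R) → ¬ Property1 mb P
  common-neighbours-near⇒¬Property1 P Q₁ Q₂ Q₁∈B Q₂∈B P-Q₁ P-Q₂ Q₁≉Q₂ Q₁≁Q₂ near property1
    with property1 Q₁ Q₂ Q₁∈B Q₂∈B P-Q₁ P-Q₂ Q₁≉Q₂ Q₁≁Q₂
  ... | R , _ , Q₁-R , Q₂-R , R≉P , P≁R , _ = P≁R (R≉P ∘ ≈P-sym {P} {R} , near {R} Q₁-R Q₂-R)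

  module Merge (P : ISPartition G) (a c : Fin n)
               (apart : ∀ {u v} → a ∼[ P ] u → c ∼[ P ] v → ¬ Adj G u v) where

    InEither : Fin n → Set
    InEither u = a ∼[ P ] u ⊎ c ∼[ P ] u

    inEither : Fin n → Bool
    inEither u = same P a u ∨ same P c u

    joined : Fin n → Fin n → Bool
    joined u v = same P u v ∨ (inEither u ∧ inEither v)

    joined⁻ : ∀ {u v} → joined u v ≡ true → u ∼[ P ] v ⊎ (InEither u × InEither v)
    joined⁻ uv with ∨-true⁻ uv
    ... | inj₁ uv′ = inj₁ uv′
    ... | inj₂ eu∧ev with ∧-true⁻ eu∧ev
    ...   | eu , ev = inj₂ (∨-true⁻ eu , ∨-true⁻ ev)

    joined-⊒ : ∀ {u v} → u ∼[ P ] v → joined u v ≡ true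
    joined-⊒ uv = ∨-true⁺ (inj₁ uv)

    joined-either : ∀ {u v} → InEither u → InEither v → joined u v ≡ true
    joined-either eu ev = ∨-true⁺ (inj₂ (∧-true⁺ (∨-true⁺ eu) (∨-true⁺ ev)))

    InEither-resp : ∀ {u v} → u ∼[ P ] v → InEither u → InEither v
    InEither-resp uv (inj₁ au) = inj₁ (∼-trans P au uv)
    InEither-resp uv (inj₂ cu) = inj₂ (∼-trans P cu uv)

    joined-trans : ∀ {u v w} → joined u v ≡ true → joined v w ≡ true → joined u w ≡ true
    joined-trans uv vw with joined⁻ uv | joined⁻ vw
    ... | inj₁ uv′       | inj₁ vw′       = joined-⊒ (∼-trans P uv′ vw′)
    ... | inj₁ uv′       | inj₂ (ev , ew) = joined-either (InEither-resp (∼-sym P uv′) ev) ew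
    ... | inj₂ (eu , ev) | inj₁ vw′       = joined-either eu (InEither-resp vw′ ev)
    ... | inj₂ (eu , _)  | inj₂ (_ , ew)  = joined-either eu ew

    joined-indep : ∀ {u v} → joined u v ≡ true → ¬ Adj G u v
    joined-indep uv with joined⁻ uv
    ... | inj₁ uv′                = indep P _ _ uv′
    ... | inj₂ (inj₁ au , inj₁ av) = indep P _ _ (∼-mates P au av)
    ... | inj₂ (inj₂ cu , inj₂ cv) = indep P _ _ (∼-mates P cu cv)
    ... | inj₂ (inj₁ au , inj₂ cv) = apart au cv
    ... | inj₂ (inj₂ cu , inj₁ av) = apart av cu ∘ Adj-sym G

    merge : ISPartition G
    merge = record
      { same       = joined
      ; same-refl  = λ u → joined-⊒ (same-refl P u)
      ; same-sym   = λ u v uv → [ joined-⊒ ∘ ∼-sym P , (λ (eu , ev) → joined-either ev eu) ] (joined⁻ uv)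
      ; same-trans = λ _ _ _ → joined-trans
      ; indep      = λ _ _ → joined-indep
      }

    merge-agreeOff : (∀ {u} → c ∼[ P ] u → u ≡ c) → AgreeOff c P merge
    merge-agreeOff c-single u v u≢c v≢c = true⇔true⇒≡ joined-⊒ split
      where
      in-a : ∀ {w} → w ≢ c → InEither w → a ∼[ P ] w
      in-a _   (inj₁ aw) = aw
      in-a w≢c (inj₂ cw) = contradiction (c-single cw) w≢c

      split : joined u v ≡ true → u ∼[ P ] v
      split uv = [ id , (λ (eu , ev) → ∼-mates P (in-a u≢c eu) (in-a v≢c ev)) ] (joined⁻ uv)

    pigeonhole : ∀ {u v w} → InEither u → InEither v → InEither w →
      ¬ u ∼[ P ] v → ¬ v ∼[ P ] w → u ∼[ P ] w
    pigeonhole (inj₁ au) _         (inj₁ aw) _   _   = ∼-mates P au aw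
    pigeonhole (inj₂ cu) _         (inj₂ cw) _   _   = ∼-mates P cu cw
    pigeonhole (inj₁ au) (inj₁ av) (inj₂ _)  u≁v _   = contradiction (∼-mates P au av) u≁v
    pigeonhole (inj₂ cu) (inj₂ cv) (inj₁ _)  u≁v _   = contradiction (∼-mates P cu cv) u≁v
    pigeonhole (inj₁ _)  (inj₂ cv) (inj₂ cw) _   v≁w = contradiction (∼-mates P cv cw) v≁w
    pigeonhole (inj₂ _)  (inj₁ av) (inj₁ aw) _   v≁w = contradiction (∼-mates P av aw) v≁w

    lost-leader-witness : ∀ {v} → isLeader P v ≡ true → isLeader merge v ≡ false →
      ∃ λ u → toℕ u < toℕ v × ¬ u ∼[ P ] v × InEither u × InEither v
    lost-leader-witness lv lost with nonleader⇒smaller-mate merge lost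
    ... | u , u<v , uv with joined⁻ uv
    ...   | inj₁ uv′        = contradiction u<v (leader-minimal P lv uv′)
    ...   | inj₂ (eu , ev)  = u , u<v , (λ uv′ → leader-minimal P lv uv′ u<v) , eu , ev

    -- w is not in v's part, which has only one leader, so by pigeonhole it is in the part
    -- of the witness u < v.
    lost-leaders-ordered : ∀ {v w} → isLeader P v ≡ true → isLeader merge v ≡ false →
      isLeader P w ≡ true → isLeader merge w ≡ false → w ≢ v → toℕ w < toℕ v
    lost-leaders-ordered {v} {w} lv lost-v lw lost-w w≢v
      with lost-leader-witness lv lost-v | lost-leader-witness lw lost-w
    ... | u , u<v , u≁v , eu , ev | _ , _ , _ , _ , ew =
      ≤-<-trans (leader-≤ P lw (∼-sym P w∼u)) u<v
      where
      w∼u : w ∼[ P ] u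
      w∼u = pigeonhole ew ev eu (w≢v ∘ leaders-unique P lw lv) (u≁v ∘ ∼-sym P)

    lost-leader-unique : ∀ {v w} → isLeader P v ≡ true → isLeader merge v ≡ false →
      isLeader P w ≡ true → isLeader merge w ≡ false → v ≡ w
    lost-leader-unique {v} {w} lv lost-v lw lost-w with v ≟ w
    ... | yes v≡w = v≡w
    ... | no v≢w  = contradiction (lost-leaders-ordered lw lost-w lv lost-v v≢w)
                                  (<-asym (lost-leaders-ordered lv lost-v lw lost-w (≢-sym v≢w)))

    numParts-merge : numParts P ≤ suc (numParts merge)
    numParts-merge = length-filterᵇ-≤-suc (isLeader P) (isLeader merge) (allFin⁺ n) lost-leader-unique

  module Isolate (P : ISPartition G) (a : Fin n) where

    isA : Fin n → Bool
    isA u = does (u ≟ a)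

    isolated : Fin n → Fin n → Bool
    isolated u v = same P u v ∧ does (isA u Bool.≟ isA v)

    isolated-intro : ∀ {u v} → u ∼[ P ] v → isA u ≡ isA v → isolated u v ≡ true
    isolated-intro uv l = ∧-true⁺ uv (dec-true (_ Bool.≟ _) l)

    isolated-label : ∀ {u v} → isolated u v ≡ true → isA u ≡ isA v
    isolated-label = from-does (_ Bool.≟ _) ∘ proj₂ ∘ ∧-true⁻

    isolate : ISPartition G
    isolate = record
      { same       = isolated
      ; same-refl  = λ u → isolated-intro (same-refl P u) refl
      ; same-sym   = λ u v uv → isolated-intro (∼-sym P (proj₁ (∧-true⁻ uv))) (sym (isolated-label uv))
      ; same-trans = λ u v w uv vw → isolated-intro (∼-trans P (proj₁ (∧-true⁻ uv)) (proj₁ (∧-true⁻ vw)))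
                                                    (trans (isolated-label uv) (isolated-label vw))
      ; indep      = λ u v uv → indep P u v (proj₁ (∧-true⁻ uv))
      }

    isolate-⊑ : isolate ⊑ P
    isolate-⊑ = proj₁ ∘ ∧-true⁻

    isolate-singleton : ∀ {u} → a ∼[ isolate ] u → u ≡ a
    isolate-singleton {u} au = from-does (u ≟ a) (trans (sym (isolated-label au)) (dec-true (a ≟ a) refl))

    isolate-agreeOff-if : ∀ {x} → (∀ {u v} → u ≢ x → v ≢ x → u ∼[ P ] v → (u ≡ a ⇔ v ≡ a)) →
      AgreeOff x P isolate
    isolate-agreeOff-if same-side u v u≢x v≢x =
      true⇔true⇒≡ (λ uv → isolated-intro uv (does-⇔ (same-side u≢x v≢x uv) (u ≟ a) (v ≟ a))) isolate-⊑

    isolate-agreeOff : AgreeOff a P isolate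
    isolate-agreeOff = isolate-agreeOff-if λ u≢a v≢a _ → mk⇔ (⊥-elim ∘ u≢a) (⊥-elim ∘ v≢a)

  module Configuration
    (P : ISPartition G) (a b c : Fin n) (b≢a : b ≢ a) (a∼b : a ∼[ P ] b)
    (a-part : ∀ {u} → a ∼[ P ] u → u ≡ a ⊎ u ≡ b) (c-part : ∀ {u} → c ∼[ P ] u → u ≡ c)
    (a≁c : ¬ a ∼[ P ] c) (no-edge : ∀ u → a ∼[ P ] u → ¬ Adj G u c) where

    a≢b : a ≢ b
    a≢b = ≢-sym b≢a

    c≢a : c ≢ a
    c≢a refl = a≁c (same-refl P a)

    c≢b : c ≢ b
    c≢b refl = a≁c a∼b

    apart : ∀ {u v} → a ∼[ P ] u → c ∼[ P ] v → ¬ Adj G u v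
    apart {u} au cv with refl ← c-part cv = no-edge u au

    open Merge P a c apart using (merge; joined-either; merge-agreeOff; numParts-merge)
    open Isolate P a using (isolate; isolate-⊑; isolate-singleton; isolate-agreeOff-if; isolate-agreeOff)

    Q₁ Q₂ : ISPartition G
    Q₁ = merge
    Q₂ = isolate

    Q₁-a∼b : a ∼[ Q₁ ] b
    Q₁-a∼b = joined-either (inj₁ (same-refl P a)) (inj₁ a∼b)

    Q₁-a∼c : a ∼[ Q₁ ] c
    Q₁-a∼c = joined-either (inj₁ (same-refl P a)) (inj₂ (same-refl P c))

    Q₁-b∼c : b ∼[ Q₁ ] c
    Q₁-b∼c = joined-either (inj₁ a∼b) (inj₂ (same-refl P c))

    Q₂-b-singleton : ∀ {u} → b ∼[ Q₂ ] u → u ≡ b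
    Q₂-b-singleton bu with a-part (∼-trans P a∼b (isolate-⊑ bu))
    ... | inj₂ u≡b = u≡b
    ... | inj₁ refl = contradiction (∼-sym Q₂ bu) (b≢a ∘ isolate-singleton)

    Q₁-moves-c : AgreeOff c P Q₁
    Q₁-moves-c = merge-agreeOff c-part

    Q₂-moves-a : AgreeOff a P Q₂
    Q₂-moves-a = isolate-agreeOff

    Q₂-moves-b : AgreeOff b P Q₂
    Q₂-moves-b = isolate-agreeOff-if λ u≢b v≢b uv → mk⇔ (to-a v≢b uv) (to-a u≢b (∼-sym P uv))
      where
      to-a : ∀ {u v} → v ≢ b → u ∼[ P ] v → u ≡ a → v ≡ a
      to-a v≢b av refl = [ id , (λ v≡b → contradiction v≡b v≢b) ] (a-part av)

    numParts-Q₁ : numParts P ≤ suc (numParts Q₁)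
    numParts-Q₁ = numParts-merge

    numParts-Q₂ : numParts P ≤ numParts Q₂
    numParts-Q₂ = numParts-mono {P} {Q₂} isolate-⊑

    Q₂-a≁b : ¬ a ∼[ Q₂ ] b
    Q₂-a≁b = b≢a ∘ isolate-singleton

    Q₂-a≁c : ¬ a ∼[ Q₂ ] c
    Q₂-a≁c = c≢a ∘ isolate-singleton

    Q₂-b≁c : ¬ b ∼[ Q₂ ] c
    Q₂-b≁c = c≢b ∘ Q₂-b-singleton

    separated : ∀ {R x y p q} → AgreeOff x Q₁ R → AgreeOff y Q₂ R →
      p ∼[ Q₁ ] q → ¬ p ∼[ Q₂ ] q → p ≢ x → q ≢ x → p ≢ y → q ≢ y → ⊥
    separated {R} = agreeOff-separates Q₁ Q₂ R

    Q₁-Q₂-nonadjacent : ¬ BAdj Q₁ Q₂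
    Q₁-Q₂-nonadjacent (_ , z , Q₁≃Q₂) with a ≟ z | b ≟ z
    ... | yes refl | _        = separated {Q₂} Q₁≃Q₂ (agreeOff-refl Q₂) Q₁-b∼c Q₂-b≁c b≢a c≢a b≢a c≢a
    ... | no _     | yes refl = separated {Q₂} Q₁≃Q₂ (agreeOff-refl Q₂) Q₁-a∼c Q₂-a≁c a≢b c≢b a≢b c≢b
    ... | no a≢z   | no b≢z   = separated {Q₂} Q₁≃Q₂ (agreeOff-refl Q₂) Q₁-a∼b Q₂-a≁b a≢z b≢z a≢z b≢z

    common-neighbour-near : ∀ {R x y} → AgreeOff x Q₁ R → AgreeOff y Q₂ R → ∃ λ v → AgreeOff v P R
    -- By `separated`, each of the pairs ab, ac, bc contains x or y.
    common-neighbour-near {R} {x} {y} Q₁≃R Q₂≃R with c ≟ x | a ≟ y | b ≟ y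
    ... | yes refl | _        | _        = c , agreeOff-trans P Q₁ R Q₁-moves-c Q₁≃R
    ... | no _     | yes refl | _        = a , agreeOff-trans P Q₂ R Q₂-moves-a Q₂≃R
    ... | no _     | no _     | yes refl = b , agreeOff-trans P Q₂ R Q₂-moves-b Q₂≃R
    ... | no c≢x   | no a≢y   | no b≢y with c ≟ y | a ≟ x | b ≟ x
    ...   | no c≢y   | yes refl | _        =
      ⊥-elim (separated {R} Q₁≃R Q₂≃R Q₁-b∼c Q₂-b≁c b≢a c≢x b≢y c≢y)
    ...   | no c≢y   | no a≢x   | _        =
      ⊥-elim (separated {R} Q₁≃R Q₂≃R Q₁-a∼c Q₂-a≁c a≢x c≢x a≢y c≢y)
    ...   | yes refl | yes refl | _        =
      b , agreeOff-transfer P Q₂ R (≢-sym c≢b) c-part Q₂-b-singleton Q₂-moves-b Q₂≃R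
            (trans (sym (Q₁≃R b c b≢a c≢a)) Q₁-b∼c)
    ...   | yes refl | no _     | yes refl =
      a , agreeOff-transfer P Q₂ R (≢-sym c≢a) c-part isolate-singleton Q₂-moves-a Q₂≃R
            (trans (sym (Q₁≃R a c a≢b c≢b)) Q₁-a∼c)
    ...   | yes refl | no a≢x   | no b≢x   =
      ⊥-elim (separated {R} Q₁≃R Q₂≃R Q₁-a∼b Q₂-a≁b a≢x b≢x a≢y b≢y)

    ¬property1 : ∀ {mb} → InB mb Q₁ → InB mb Q₂ → ¬ Property1 mb P
    ¬property1 Q₁∈B Q₂∈B =
      common-neighbours-near⇒¬Property1 P Q₁ Q₂ Q₁∈B Q₂∈B
        (≉-witness Q₁ P Q₁-a∼c a≁c ∘ ≈P-sym {P} {Q₁} , c , Q₁-moves-c)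
        (≉-witness P Q₂ a∼b Q₂-a≁b , a , Q₂-moves-a)
        (≉-witness Q₁ Q₂ Q₁-a∼b Q₂-a≁b) Q₁-Q₂-nonadjacent
        (λ {R} (_ , _ , Q₁≃R) (_ , _ , Q₂≃R) → common-neighbour-near {R} Q₁≃R Q₂≃R)

lemma2p6 : (n : ℕ) (G : Graph n) (mb : Maybe ℕ) →
    (∀ k → mb ≡ just k → k ≤ n ∸ 1) →
    (P : ISPartition G) → InB mb P →
    (a c : Fin n) → partSize P a ≡ 2 → partSize P c ≡ 1 →
    same P a c ≡ false →
    (∀ u → same P a u ≡ true → ¬ Adj G u c) →
    ¬ Property1 mb P ⊎ (∃ λ k → mb ≡ just k × numParts P ≡ k)
lemma2p6 n G mb _ P P∈B a c size-a size-c a-c-false no-edge with partSize≡2⇒doubleton P size-a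
... | b , b≢a , a∼b , a-part = conclude mb P∈B
  where
  open Configuration P a b c b≢a a∼b a-part (partSize≡1⇒singleton P size-c)
                     (λ a∼c → contradiction (trans (sym a∼c) a-c-false) λ ()) no-edge

  conclude : ∀ mb → InB mb P → ¬ Property1 mb P ⊎ (∃ λ k → mb ≡ just k × numParts P ≡ k)
  conclude nothing  _   = inj₁ (¬property1 tt tt)
  conclude (just k) k≤P with numParts P ≟ℕ k
  ... | yes P≡k = inj₂ (k , refl , P≡k)
  ... | no  P≢k = inj₁ (¬property1 (s≤s⁻¹ (≤-trans (≤∧≢⇒< k≤P (≢-sym P≢k)) numParts-Q₁))
                                   (≤-trans k≤P numParts-Q₂))
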